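{- Let $f(x)\in\mathbb{Z}[x]$ be such that $f(x)+x$ is nonconstant and $0$ is periodic under $x\mapsto f(x)$ with exact period length $2$. Write $f^2(x)=x^rG(x)$ with $G(x)\in\mathbb{Z}[x]$, $G(0)\neq0$ and $r\ge1$. Let $x_0\in\mathbb{Z}$ have a wandering orbit $(x_n)_{n\ge0}$ under $f$, and define \[ a_{n+2}=\frac{G(x_n)}{\gcd(G(x_n),G(0)f(0))}\quad\text{for all } n\ge0. \] Then $(a_n)_{n\ge2}$ is an infinite sequence of pairwise coprime integers, and for all sufficiently large $n$, $a_n$ has a private prime factor.
   Context: $f^n$ denotes the $n$-fold composition of $f$; the orbit of $x_0$ is $x_n=f^n(x_0)$. $0$ is periodic with exact period length $2$ means $f(0)\neq0$ and $f^2(0)=0$. The orbit is wandering if the $x_n$, $n\ge0$, are pairwise distinct. For a sequence of integers $(a_n)$, a prime $p$ is a private prime factor of $a_n$ if $p$ divides $a_n$ and no other term $a_m$, $m\ne n$. -}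

module Defs where

open import Data.Nat as ℕ using (ℕ; zero; suc)
open import Data.Integer using (ℤ; +_; _+_; _*_; ∣_∣)
open import Data.Integer.DivMod using (_/ℕ_)
open import Data.List using (List; []; _∷_; foldr)
import Data.Nat.GCD as NG

-- Polynomials in ℤ[x] as coefficient lists, lowest degree first.
Poly : Set
Poly = List ℤ

coeff : Poly → ℕ → ℤ
coeff []       _       = + 0
coeff (c ∷ p)  zero    = c
coeff (c ∷ p)  (suc i) = coeff p i

_⊕_ : Poly → Poly → Poly
[]      ⊕ q       = q
(c ∷ p) ⊕ []      = c ∷ p
(c ∷ p) ⊕ (d ∷ q) = (c + d) ∷ (p ⊕ q)

scale : ℤ → Poly → Poly
scale a []      = []
scale a (c ∷ p) = (a * c) ∷ scale a p

_⊛_ : Poly → Poly → Poly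
[]      ⊛ q = []
(c ∷ p) ⊛ q = scale c q ⊕ (+ 0 ∷ (p ⊛ q))

comp : Poly → Poly → Poly
comp f g = foldr (λ c acc → (c ∷ []) ⊕ (g ⊛ acc)) [] f

Xp : Poly
Xp = + 0 ∷ + 1 ∷ []

Xpow : ℕ → Poly
Xpow zero    = + 1 ∷ []
Xpow (suc r) = + 0 ∷ Xpow r

_≐_ : Poly → Poly → Set
p ≐ q = ∀ i → coeff p i Relation.Binary.PropositionalEquality.≡ coeff q i
  where import Relation.Binary.PropositionalEquality

NonConstant : Poly → Set
NonConstant p = Σ ℕ (λ i → (1 ℕ.≤ i) × ¬ (coeff p i ≡ + 0))
  where open import Data.Product using (Σ; _×_)
        open import Relation.Nullary using (¬_)
        open import Relation.Binary.PropositionalEquality using (_≡_)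

eval : Poly → ℤ → ℤ
eval p x = foldr (λ c acc → c + x * acc) (+ 0) p

iter : (ℤ → ℤ) → ℕ → ℤ → ℤ
iter g zero    x = x
iter g (suc n) x = g (iter g n x)

orbit : Poly → ℤ → ℕ → ℤ
orbit f x0 n = iter (eval f) n x0

-- aTerm f G x0 n  is  a_{n+2} = G(x_n) / gcd(G(x_n), G(0) f(0))
-- (gcd taken as the nonnegative gcd; the degenerate case gcd = 0 cannot occur
--  under the hypotheses G(0) ≠ 0, f(0) ≠ 0, and is set to 0 only for totality)
aTerm : Poly → Poly → ℤ → ℕ → ℤ
aTerm f G x0 n with NG.gcd ∣ eval G (orbit f x0 n) ∣ ∣ eval G (+ 0) * eval f (+ 0) ∣
... | zero  = + 0
... | suc k = eval G (orbit f x0 n) /ℕ suc k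

-- Write F for evaluation of f, b = F(0), c = G(0), C = |c·b| and x_n for the orbit of
-- x0, so that F(F(y)) = y^r·G(y) and a_{n+2} = G(x_n)/gcd(G(x_n), C).
--
-- Polynomials respect congruences and the orbit of 0 is 0, b, 0, b, ...
-- If d | G(x_m) then d | x_{m+2}, so x_{m+2+j} ≡ F^j(0) (mod d); comparing with a later
-- G(x_n) shows that d | b or d | c.  Hence common divisors of G(x_m), G(x_n) divide C,
-- and a gcd computation (coprime-cofactors) makes a_m and a_n coprime.
--
-- G is not constant: otherwise F(F(y)) = c·y^r, which for r = 1 makes
-- F an involution (contradicting wandering) and for r ≥ 2 is impossible by a divisibility
-- argument (NoMonomialIterate).  Nonconstant polynomials are large at large arguments; a
-- wandering orbit gets large (pigeonhole) and then stays large, since |F(F(y))| ≥ |y|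
-- for large y.  So eventually |G(x_n)| > C, a_n ≥ 2, and any prime factor of a_n is
-- private by coprimality.
module Submission where

open import Defs
open import Data.Nat as ℕ using (ℕ; zero; suc; z≤n; s≤s; _≤_; _<_)
open import Data.Integer as ℤ using (ℤ; +_; -[1+_]; _+_; _*_; _-_; ∣_∣; _^_; _/ℕ_)
open import Data.Integer.Properties
open import Data.Integer.Tactic.RingSolver using (solve-∀)
open import Data.Integer.Divisibility.Signed as ℤ∣ using ()
  renaming (_∣_ to _∣ℤ_; divides to dividesℤ)
open import Data.List using ([]; _∷_)
open import Data.Product using (Σ; _,_; proj₁; proj₂; _×_)
open import Data.Sum using (_⊎_; inj₁; inj₂)
open import Data.Empty using (⊥; ⊥-elim)
open import Relation.Nullary using (¬_; yes; no)
open import Relation.Binary.PropositionalEquality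
import Data.Nat.Properties as ℕP
import Data.Nat.Tactic.RingSolver as ℕSolver
open import Data.Nat.Divisibility using (_∣_; ∣-trans; divides)
import Data.Nat.Divisibility as ℕ∣
import Data.Nat.DivMod as ℕDM
open import Data.Nat.GCD
  using (gcd; gcd[m,n]∣m; gcd[m,n]∣n; gcd-greatest; gcd[m,n]≡0⇒m≡0; gcd[m,n]≡0⇒n≡0;
         c*gcd[m,n]≡gcd[cm,cn])
open import Data.Nat.Primality using (Prime; ¬prime[1])
open import Data.Nat.Primality.Factorisation using (factorise)
open import Data.Nat.ListAction using (product)
open import Data.List.Relation.Unary.All using (_∷_)
open import Data.Fin as Fin using (Fin; toℕ; fromℕ<)
import Data.Fin.Properties as FinP
open import Relation.Binary.Definitions using (tri<; tri≈; tri>)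

eval-⊕ : ∀ p q x → eval (p ⊕ q) x ≡ eval p x + eval q x
eval-⊕ []      q       x = sym (+-identityˡ _)
eval-⊕ (c ∷ p) []      x = sym (+-identityʳ _)
eval-⊕ (c ∷ p) (d ∷ q) x rewrite eval-⊕ p q x = lemma c d x (eval p x) (eval q x)
  where lemma : ∀ c d x a b → (c + d) + x * (a + b) ≡ (c + x * a) + (d + x * b)
        lemma = solve-∀

eval-scale : ∀ a p x → eval (scale a p) x ≡ a * eval p x
eval-scale a []      x = sym (*-zeroʳ a)
eval-scale a (c ∷ p) x rewrite eval-scale a p x = lemma a c x (eval p x)
  where lemma : ∀ a c x e → a * c + x * (a * e) ≡ a * (c + x * e)
        lemma = solve-∀

eval-⊛ : ∀ p q x → eval (p ⊛ q) x ≡ eval p x * eval q x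
eval-⊛ []      q x = refl
eval-⊛ (c ∷ p) q x
  rewrite eval-⊕ (scale c q) (+ 0 ∷ (p ⊛ q)) x | eval-scale c q x | eval-⊛ p q x
  = lemma c x (eval p x) (eval q x)
  where lemma : ∀ c x a b → c * b + (+ 0 + x * (a * b)) ≡ (c + x * a) * b
        lemma = solve-∀

eval-comp : ∀ f g x → eval (comp f g) x ≡ eval f (eval g x)
eval-comp []      g x = refl
eval-comp (c ∷ f) g x
  rewrite eval-⊕ (c ∷ []) (g ⊛ comp f g) x | eval-⊛ g (comp f g) x | eval-comp f g x
  = lemma c x (eval g x) (eval f (eval g x))
  where lemma : ∀ c x a b → (c + x * + 0) + a * b ≡ c + a * b
        lemma = solve-∀

eval-Xpow : ∀ r x → eval (Xpow r) x ≡ x ^ r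
eval-Xpow zero    x = cong (λ t → + 1 + t) (*-zeroʳ x)
eval-Xpow (suc r) x rewrite eval-Xpow r x = +-identityˡ _

AllZero : Poly → Set
AllZero p = ∀ i → coeff p i ≡ + 0

eval-AllZero : ∀ p x → AllZero p → eval p x ≡ + 0
eval-AllZero []      x h = refl
eval-AllZero (c ∷ p) x h rewrite h 0 | eval-AllZero p x (λ i → h (suc i)) =
  trans (+-identityˡ _) (*-zeroʳ x)

eval-≐ : ∀ p q x → p ≐ q → eval p x ≡ eval q x
eval-≐ []      []      x h = refl
eval-≐ []      (d ∷ q) x h = sym (eval-AllZero (d ∷ q) x (λ i → sym (h i)))
eval-≐ (c ∷ p) []      x h = eval-AllZero (c ∷ p) x h
eval-≐ (c ∷ p) (d ∷ q) x h rewrite h 0 | eval-≐ p q x (λ i → h (suc i)) = refl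

eval-cong : ∀ p {d} a b → d ∣ℤ a - b → d ∣ℤ eval p a - eval p b
eval-cong []      {d} _ _ _   = dividesℤ (+ 0) (sym (*-zeroˡ d))
eval-cong (c ∷ p) {d} a b a≡b = subst (d ∣ℤ_) (lemma c a b (eval p a) (eval p b))
  (ℤ∣.∣m∣n⇒∣m+n (ℤ∣.∣m⇒∣m*n (eval p a) a≡b) (ℤ∣.∣n⇒∣m*n b (eval-cong p a b a≡b)))
  where lemma : ∀ c a b P Q → (a - b) * P + b * (P - Q) ≡ (c + a * P) - (c + b * Q)
        lemma = solve-∀

NonZeroPoly : Poly → Set
NonZeroPoly p = Σ ℕ λ i → ¬ coeff p i ≡ + 0

allZero? : ∀ p → AllZero p ⊎ NonZeroPoly p
allZero? []      = inj₁ (λ _ → refl)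
allZero? (c ∷ p) with c ≟ + 0 | allZero? p
... | no c≢0 | _            = inj₂ (0 , c≢0)
... | yes _  | inj₂ (i , h) = inj₂ (suc i , h)
... | yes c≡0 | inj₁ p≡0    = inj₁ λ { zero → c≡0 ; (suc i) → p≡0 i }

eval-const : ∀ c q y → AllZero q → eval (c ∷ q) y ≡ c
eval-const c q y q≡0 rewrite eval-AllZero q y q≡0 | *-zeroʳ y = +-identityʳ c

nonConstant : ∀ p → ¬ (∀ y → eval p y ≡ eval p (+ 0)) → NonConstant p
nonConstant []      notConst = ⊥-elim (notConst λ _ → refl)
nonConstant (c ∷ q) notConst with allZero? q
... | inj₂ (i , h) = suc i , s≤s z≤n , h
... | inj₁ q≡0     = ⊥-elim (notConst λ y →
  trans (eval-const c q y q≡0) (sym (eval-const c q (+ 0) q≡0)))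

triangle : ∀ c y e → ¬ e ≡ + 0 → ∣ y ∣ ≤ ∣ c + y * e ∣ ℕ.+ ∣ c ∣
triangle c y e e≢0 = begin
  ∣ y ∣                     ≤⟨ ℕP.m≤m*n ∣ y ∣ ∣ e ∣ {{ℤ.≢-nonZero e≢0}} ⟩
  ∣ y ∣ ℕ.* ∣ e ∣           ≡⟨ abs-* y e ⟨
  ∣ y * e ∣                 ≡⟨ cong ∣_∣ (lemma c y e) ⟩
  ∣ (c + y * e) - c ∣       ≤⟨ ∣i-j∣≤∣i∣+∣j∣ (c + y * e) c ⟩
  ∣ c + y * e ∣ ℕ.+ ∣ c ∣   ∎
  where open ℕP.≤-Reasoning
        lemma : ∀ c y e → y * e ≡ (c + y * e) - c
        lemma = solve-∀

head-nonzero : ∀ {c q} → NonZeroPoly (c ∷ q) → AllZero q → ¬ c ≡ + 0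
head-nonzero (zero  , c≢0) _   = c≢0
head-nonzero (suc i , h)   q≡0 = ⊥-elim (h (q≡0 i))

growth-from-tail : ∀ c q → (Σ ℕ λ T → ∀ y → T ≤ ∣ y ∣ → ¬ eval q y ≡ + 0) →
  ∀ K → Σ ℕ λ B → ∀ y → B ≤ ∣ y ∣ → K < ∣ eval (c ∷ q) y ∣
growth-from-tail c q (T , hT) K = T ℕ.+ (suc K ℕ.+ ∣ c ∣) , λ y le →
  ℕP.+-cancelʳ-≤ ∣ c ∣ (suc K) _ (ℕP.≤-trans (ℕP.≤-trans (ℕP.m≤n+m _ T) le)
    (triangle c y (eval q y) (hT y (ℕP.≤-trans (ℕP.m≤m+n T _) le))))

eventually-nonzero : ∀ p → NonZeroPoly p → Σ ℕ λ T → ∀ y → T ≤ ∣ y ∣ → ¬ eval p y ≡ + 0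
eventually-nonzero []      (i , h) = ⊥-elim (h refl)
eventually-nonzero (c ∷ q) nz with allZero? q
... | inj₁ q≡0 = 0 , λ y _ p[y]≡0 →
  head-nonzero nz q≡0 (trans (sym (eval-const c q y q≡0)) p[y]≡0)
... | inj₂ q≢0 with growth-from-tail c q (eventually-nonzero q q≢0) 0
... | T , hT = T , λ y le p[y]≡0 →
  ℕP.<-irrefl refl (subst (λ v → 0 < ∣ v ∣) p[y]≡0 (hT y le))

growth : ∀ p → NonConstant p → ∀ K → Σ ℕ λ B → ∀ y → B ≤ ∣ y ∣ → K < ∣ eval p y ∣
growth []      (i , _ , h)     = ⊥-elim (h refl)
growth (c ∷ q) (zero , () , _)
growth (c ∷ q) (suc i , _ , h) = growth-from-tail c q (eventually-nonzero q (i , h))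

eval-at-0 : ∀ p → eval p (+ 0) ≡ coeff p 0
eval-at-0 []      = refl
eval-at-0 (c ∷ p) = +-identityʳ c

lowest-term : ∀ q → NonZeroPoly q →
  Σ ℕ λ k → Σ Poly λ U → (¬ eval U (+ 0) ≡ + 0) × (∀ y → eval q y ≡ y ^ k * eval U y)
lowest-term []      (i , h) = ⊥-elim (h refl)
lowest-term (c ∷ q) nz with c ≟ + 0
... | no c≢0 = 0 , c ∷ q , (λ e → c≢0 (trans (sym (eval-at-0 (c ∷ q))) e)) ,
  λ y → sym (*-identityˡ _)
lowest-term (c ∷ q) (zero  , c≢0) | yes c≡0 = ⊥-elim (c≢0 c≡0)
lowest-term (c ∷ q) (suc i , h)   | yes refl with lowest-term q (i , h)
... | k , U , U[0]≢0 , hq = suc k , U , U[0]≢0 , λ y → begin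
  + 0 + y * eval q y            ≡⟨ +-identityˡ _ ⟩
  y * eval q y                  ≡⟨ cong (y *_) (hq y) ⟩
  y * (y ^ k * eval U y)        ≡⟨ *-assoc y (y ^ k) (eval U y) ⟨
  y * y ^ k * eval U y          ∎
  where open ≡-Reasoning

nonconstant-expansion : ∀ p → NonConstant p →
  Σ ℕ λ k → Σ Poly λ U → (¬ eval U (+ 0) ≡ + 0) ×
    (∀ y → eval p y ≡ eval p (+ 0) + y ^ suc k * eval U y)
nonconstant-expansion []      (i , _ , h)     = ⊥-elim (h refl)
nonconstant-expansion (c ∷ q) (zero , () , _)
nonconstant-expansion (c ∷ q) (suc i , _ , h) with lowest-term q (i , h)
... | k , U , U[0]≢0 , hq = k , U , U[0]≢0 , λ y → begin
  c + y * eval q y              ≡⟨ cong (λ t → c + y * t) (hq y) ⟩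
  c + y * (y ^ k * eval U y)
    ≡⟨ cong₂ _+_ (sym (+-identityʳ c)) (sym (*-assoc y (y ^ k) (eval U y))) ⟩
  c + + 0 + y * y ^ k * eval U y ∎
  where open ≡-Reasoning

iter-+ : ∀ (g : ℤ → ℤ) j i x → iter g (j ℕ.+ i) x ≡ iter g j (iter g i x)
iter-+ g zero    i x = refl
iter-+ g (suc j) i x = cong g (iter-+ g j i x)

iter-cong : ∀ p j {d} a b → d ∣ℤ a - b → d ∣ℤ iter (eval p) j a - iter (eval p) j b
iter-cong p zero    a b a≡b = a≡b
iter-cong p (suc j) a b a≡b =
  eval-cong p (iter (eval p) j a) (iter (eval p) j b) (iter-cong p j a b a≡b)

parity : ∀ t → Σ ℕ λ k → t ≡ k ℕ.+ k ⊎ t ≡ suc (k ℕ.+ k)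
parity zero = 0 , inj₁ refl
parity (suc t) with parity t
... | k , inj₁ refl = k , inj₂ refl
... | k , inj₂ refl = suc k , inj₁ (cong suc (sym (ℕP.+-suc k k)))

period-two : ∀ (g : ℤ → ℤ) → g (g (+ 0)) ≡ + 0 → ∀ k → iter g (k ℕ.+ k) (+ 0) ≡ + 0
period-two g g²[0]≡0 zero = refl
period-two g g²[0]≡0 (suc k) rewrite ℕP.+-suc k k | period-two g g²[0]≡0 k = g²[0]≡0

module Coding (B : ℕ) where
  index : ℤ → ℕ
  index (+ m)    = m
  index -[1+ m ] = B ℕ.+ m

  index-bound : ∀ z → ∣ z ∣ < B → index z < B ℕ.+ B
  index-bound (+ m)    m<B = ℕP.≤-trans m<B (ℕP.m≤m+n B B)
  index-bound -[1+ m ] m<B = ℕP.+-monoʳ-< B (ℕP.<-trans (ℕP.n<1+n m) m<B)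

  index-injective : ∀ z w → ∣ z ∣ < B → ∣ w ∣ < B → index z ≡ index w → z ≡ w
  index-injective (+ m)    (+ n)    _   _   refl = refl
  index-injective (+ m)    -[1+ n ] m<B _   refl = ⊥-elim (ℕP.<⇒≱ m<B (ℕP.m≤m+n B n))
  index-injective -[1+ m ] (+ n)    _   n<B refl = ⊥-elim (ℕP.<⇒≱ n<B (ℕP.m≤m+n B m))
  index-injective -[1+ m ] -[1+ n ] _   _   eq   = cong -[1+_] (ℕP.+-cancelˡ-≡ B m n eq)

-- A sequence of pairwise distinct integers takes values of arbitrarily large absolute
-- value: otherwise s(0), ..., s(2B) would be 2B+1 distinct integers in (-B, B).
-- (Opaque: later only its statement is used, and unfolding it is expensive.)
opaque
  unbounded : (s : ℕ → ℤ) → (∀ m n → ¬ m ≡ n → ¬ s m ≡ s n) →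
    ∀ B → Σ ℕ λ n → B ≤ ∣ s n ∣
  unbounded s distinct B with FinP.any? (λ (i : Fin (suc (B ℕ.+ B))) → B ℕP.≤? ∣ s (toℕ i) ∣)
  ... | yes (i , large) = toℕ i , large
  ... | no none = ⊥-elim (no-collision (FinP.pigeonhole (ℕP.n<1+n (B ℕ.+ B)) code))
    where
      open Coding B
      small : (i : Fin (suc (B ℕ.+ B))) → ∣ s (toℕ i) ∣ < B
      small i = ℕP.≰⇒> (λ large → none (i , large))
      bound : (i : Fin (suc (B ℕ.+ B))) → index (s (toℕ i)) < B ℕ.+ B
      bound i = index-bound (s (toℕ i)) (small i)
      code : Fin (suc (B ℕ.+ B)) → Fin (B ℕ.+ B)
      code i = fromℕ< (bound i)
      no-collision : ¬ (Σ (Fin (suc (B ℕ.+ B))) λ i → Σ (Fin (suc (B ℕ.+ B))) λ j →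
                          i Fin.< j × code i ≡ code j)
      no-collision (i , j , i<j , same) = distinct (toℕ i) (toℕ j) (ℕP.<⇒≢ i<j)
        (index-injective (s (toℕ i)) (s (toℕ j)) (small i) (small j)
          (trans (sym (FinP.toℕ-fromℕ< (bound i)))
            (trans (cong toℕ same) (FinP.toℕ-fromℕ< (bound j)))))

stays-large : ∀ (g : ℤ → ℤ) {A A'} → A ≤ A' →
  (∀ y → A ≤ ∣ y ∣ → ∣ y ∣ ≤ ∣ g (g y) ∣) → (∀ y → A' ≤ ∣ y ∣ → A ≤ ∣ g y ∣) →
  ∀ y → A' ≤ ∣ y ∣ → ∀ t → A ≤ ∣ iter g t y ∣
stays-large g {A} {A'} A≤A' two-steps one-step y start t = by-parity (parity t)
  where
    even-steps : ∀ k → A' ≤ ∣ iter g (k ℕ.+ k) y ∣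
    even-steps zero    = start
    even-steps (suc k) rewrite ℕP.+-suc k k =
      ℕP.≤-trans (even-steps k) (two-steps _ (ℕP.≤-trans A≤A' (even-steps k)))
    by-parity : (Σ ℕ λ k → t ≡ k ℕ.+ k ⊎ t ≡ suc (k ℕ.+ k)) → A ≤ ∣ iter g t y ∣
    by-parity (k , inj₁ even) = subst (λ t → A ≤ ∣ iter g t y ∣) (sym even)
      (ℕP.≤-trans A≤A' (even-steps k))
    by-parity (k , inj₂ odd) = subst (λ t → A ≤ ∣ iter g t y ∣) (sym odd)
      (one-step _ (even-steps k))

exact-division : ∀ z d .{{_ : ℕ.NonZero d}} → d ∣ ∣ z ∣ → ∣ z /ℕ d ∣ ℕ.* d ≡ ∣ z ∣
exact-division (+ n)    d d∣n = ℕDM.m/n*n≡m d∣n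
exact-division -[1+ n ] d d∣n with ℕ.suc n ℕ.% d in rem
... | zero  = trans (cong (ℕ._* d) (∣-i∣≡∣i∣ (+ (ℕ.suc n ℕ./ d)))) (ℕDM.m/n*n≡m d∣n)
... | suc _ = ⊥-elim (ℕP.1+n≢0 (trans (sym rem) (ℕ∣.n∣m⇒m%n≡0 (ℕ.suc n) d d∣n)))

-- With A = a·u, u = gcd(A,C), B = b·v,
-- v = gcd(B,C), d = gcd(a,b) and g = gcd(u,v): the common divisor d·g = gcd(du,dv) of
-- A and B divides C, hence u and v, hence g, which forces d = 1.
coprime-cofactors : ∀ {A B C a b} → ¬ C ≡ 0 →
  a ℕ.* gcd A C ≡ A → b ℕ.* gcd B C ≡ B → (∀ D → D ∣ A → D ∣ B → D ∣ C) → gcd a b ≡ 1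
coprime-cofactors {A} {B} {C} {a} {b} C≢0 a-cofactor b-cofactor common =
  ℕ∣.∣1⇒≡1 (ℕ∣.*-cancelʳ-∣ g {{g≢0}} (subst (d ℕ.* g ∣_) (sym (ℕP.*-identityˡ g)) dg∣g))
  where
    d = gcd a b
    u = gcd A C
    v = gcd B C
    g = gcd u v
    g≢0 : ℕ.NonZero g
    g≢0 = ℕ.≢-nonZero λ g≡0 → C≢0 (gcd[m,n]≡0⇒n≡0 A (gcd[m,n]≡0⇒m≡0 g≡0))
    du∣A : d ℕ.* u ∣ A
    du∣A = subst (d ℕ.* u ∣_) a-cofactor (ℕ∣.*-monoˡ-∣ u (gcd[m,n]∣m a b))
    dv∣B : d ℕ.* v ∣ B
    dv∣B = subst (d ℕ.* v ∣_) b-cofactor (ℕ∣.*-monoˡ-∣ v (gcd[m,n]∣n a b))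
    dg = gcd (d ℕ.* u) (d ℕ.* v)
    dg∣A : dg ∣ A
    dg∣A = ∣-trans (gcd[m,n]∣m (d ℕ.* u) (d ℕ.* v)) du∣A
    dg∣B : dg ∣ B
    dg∣B = ∣-trans (gcd[m,n]∣n (d ℕ.* u) (d ℕ.* v)) dv∣B
    dg∣C : dg ∣ C
    dg∣C = common dg dg∣A dg∣B
    dg∣g : d ℕ.* g ∣ g
    dg∣g = subst (_∣ g) (sym (c*gcd[m,n]≡gcd[cm,cn] d u v))
      (gcd-greatest (gcd-greatest dg∣A dg∣C) (gcd-greatest dg∣B dg∣C))

prime-divisor : ∀ m → 2 ≤ m → Σ ℕ λ p → Prime p × p ∣ m
prime-divisor (suc zero) (s≤s ())
prime-divisor m@(suc (suc _)) _ with factorise m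
... | record { factors = [] ; isFactorisation = () }
... | record { factors = p ∷ ps ; isFactorisation = m≡p*Πps ; factorsPrime = p-prime ∷ _ } =
  p , p-prime , divides (product ps) (trans m≡p*Πps (ℕP.*-comm p _))

∣ℤ-* : ∀ {a b c d} → a ∣ℤ b → c ∣ℤ d → a * c ∣ℤ b * d
∣ℤ-* {a} {b} {c} {d} a∣b c∣d = ℤ∣.∣-trans (ℤ∣.*-monoˡ-∣ c a∣b) (ℤ∣.*-monoʳ-∣ b c∣d)

binomial-mod-square : ∀ b H n → H * H ∣ℤ (b + H) ^ suc n - b ^ suc n - + suc n * b ^ n * H
binomial-mod-square b H zero = dividesℤ (+ 0) (lemma b H)
  where lemma : ∀ b H → (b + H) * + 1 - b * + 1 - + 1 * + 1 * H ≡ + 0 * (H * H)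
        lemma = solve-∀
binomial-mod-square b H (suc n) =
  subst (H * H ∣ℤ_) (lemma b H (+ suc n) ((b + H) ^ suc n) (b ^ n))
    (ℤ∣.∣m∣n⇒∣m+n (ℤ∣.∣n⇒∣m*n (b + H) (binomial-mod-square b H n))
                  (ℤ∣.∣n⇒∣m*n (+ suc n * b ^ n) (ℤ∣.∣-refl {H * H})))
  where lemma : ∀ b H M P B → (b + H) * (P - b * B - M * B * H) + M * B * (H * H)
                               ≡ (b + H) * P - b * (b * B) - (+ 1 + M) * (b * B) * H
        lemma = solve-∀

square-divides-power : ∀ {y z} → y * y ∣ℤ z → ∀ e → y ^ suc (suc e) ∣ℤ z ^ suc e
square-divides-power {y} {z} y²∣z zero =
  subst₂ _∣ℤ_ (cong (y *_) (sym (*-identityʳ y))) (sym (*-identityʳ z)) y²∣z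
square-divides-power {y} {z} y²∣z (suc e) =
  ∣ℤ-* (ℤ∣.∣-trans (ℤ∣.∣m⇒∣m*n y (ℤ∣.∣-refl {y})) y²∣z) (square-divides-power {y} {z} y²∣z e)

no-large-divisor : ∀ V → ¬ V ≡ + 0 → ¬ (+ suc ∣ V ∣ ∣ℤ V)
no-large-divisor V V≢0 large∣V =
  ℕP.<-irrefl refl (ℕ∣.∣⇒≤ {{ℤ.≢-nonZero V≢0}} (ℤ∣.∣⇒∣ᵤ large∣V))

-- No polynomial f with f(0) ≠ 0 has second iterate y ↦ y^(n+2)·c with c ≠ 0.
-- Write F = eval f, b = F(0) and F(y) = b + H(y), H(y) = Y·U(y), Y = y^(k+1), U(0) ≠ 0.
-- For z = F(F(y)) = y^(n+2)·c, the number F(z) - b = z^(k+1)·U(z) is divisible by y·Y,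
-- while F(z) - b = (b + H)^(n+2)·c - b^(n+2)·c ≡ K·H (mod H²), K = (n+2)·b^(n+1)·c.
-- So y·Y divides K·U(y)·Y, i.e. y | K·U(y) ≡ K·U(0) (mod y), for every y ≠ 0; but the
-- nonzero V = K·U(0) is not divisible by |V| + 1.
module NoMonomialIterate (f : Poly) (c : ℤ) (n : ℕ)
  (f[0]≢0 : ¬ eval f (+ 0) ≡ + 0) (c≢0 : ¬ c ≡ + 0)
  (f∘f : ∀ y → eval f (eval f y) ≡ y ^ suc (suc n) * c) where

  F : ℤ → ℤ
  F = eval f

  b : ℤ
  b = F (+ 0)

  -- F(F(0)) = 0, so F(b) = 0 and b = F(F(b)) = b^(n+2)·c.
  b-fixed : b ≡ b ^ suc (suc n) * c
  b-fixed = trans (sym (cong F (f∘f (+ 0)))) (f∘f b)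

  -- f is not constant, since F(F(1)) = c ≠ 0 = F(F(0)).
  f-nonconstant : NonConstant f
  f-nonconstant = nonConstant f λ const → c≢0 (begin
    c                       ≡⟨ trans (cong (_* c) (^-zeroˡ (suc (suc n)))) (*-identityˡ c) ⟨
    (+ 1) ^ suc (suc n) * c ≡⟨ f∘f (+ 1) ⟨
    F (F (+ 1))             ≡⟨ const (F (+ 1)) ⟩
    b                       ≡⟨ const b ⟨
    F b                     ≡⟨ f∘f (+ 0) ⟩
    + 0                     ∎)
    where open ≡-Reasoning

  k : ℕ
  k = proj₁ (nonconstant-expansion f f-nonconstant)

  U : Poly
  U = proj₁ (proj₂ (nonconstant-expansion f f-nonconstant))

  U[0]≢0 : ¬ eval U (+ 0) ≡ + 0
  U[0]≢0 = proj₁ (proj₂ (proj₂ (nonconstant-expansion f f-nonconstant)))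

  expand : ∀ y → F y ≡ b + y ^ suc k * eval U y
  expand = proj₂ (proj₂ (proj₂ (nonconstant-expansion f f-nonconstant)))

  K V : ℤ
  K = + suc (suc n) * b ^ suc n * c
  V = K * eval U (+ 0)

  V≢0 : ¬ V ≡ + 0
  V≢0 V≡0 with i*j≡0⇒i≡0∨j≡0 K V≡0
  ... | inj₂ U[0]≡0 = U[0]≢0 U[0]≡0
  ... | inj₁ K≡0 with i*j≡0⇒i≡0∨j≡0 (+ suc (suc n) * b ^ suc n) K≡0
  ... | inj₂ c≡0 = c≢0 c≡0
  ... | inj₁ rb≡0 with i*j≡0⇒i≡0∨j≡0 (+ suc (suc n)) rb≡0
  ... | inj₁ ()
  ... | inj₂ b^n≡0 = f[0]≢0 (i^n≡0⇒i≡0 b (suc n) b^n≡0)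

  module AtPoint (y : ℤ) (y≢0 : ¬ y ≡ + 0) where
    Y H z : ℤ
    Y = y ^ suc k
    H = Y * eval U y
    z = F (F y)

    y²∣z : y * y ∣ℤ z
    y²∣z = dividesℤ (y ^ n * c) (trans (f∘f y) (lemma y (y ^ n) c))
      where lemma : ∀ y Yn c → y * (y * Yn) * c ≡ Yn * c * (y * y)
            lemma = solve-∀

    -- F(z) - b = z^(k+1)·U(z) is divisible by y^(k+2) = y·Y.
    yY∣F[z]-b : y * Y ∣ℤ F z - b
    yY∣F[z]-b = subst (y * Y ∣ℤ_) (sym (trans (cong (_- b) (expand z)) (lemma b _)))
      (ℤ∣.∣m⇒∣m*n (eval U z) (square-divides-power {y} {z} y²∣z k))
      where lemma : ∀ b t → b + t - b ≡ t
            lemma = solve-∀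

    -- F(z) - b = (b + H)^(n+2)·c - b^(n+2)·c ≡ K·H  (mod H²).
    H²∣F[z]-b-KH : H * H ∣ℤ (F z - b) - K * H
    H²∣F[z]-b-KH = subst (H * H ∣ℤ_) (sym F[z]-b-KH)
      (ℤ∣.∣n⇒∣m*n c (binomial-mod-square b H (suc n)))
      where
        F[z]≡ : F z ≡ (b + H) ^ suc (suc n) * c
        F[z]≡ = trans (f∘f (F y)) (cong (λ t → t ^ suc (suc n) * c) (expand y))
        F[z]-b-KH : (F z - b) - K * H ≡
          c * ((b + H) ^ suc (suc n) - b ^ suc (suc n) - + suc (suc n) * b ^ suc n * H)
        F[z]-b-KH = begin
          F z - b - K * H
            ≡⟨ cong₂ (λ s t → s - t - K * H) F[z]≡ b-fixed ⟩
          (b + H) ^ suc (suc n) * c - b ^ suc (suc n) * c - K * H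
            ≡⟨ lemma ((b + H) ^ suc (suc n)) (b ^ suc (suc n)) (+ suc (suc n) * b ^ suc n) H c ⟩
          c * ((b + H) ^ suc (suc n) - b ^ suc (suc n) - + suc (suc n) * b ^ suc n * H) ∎
          where
            open ≡-Reasoning
            lemma : ∀ P Q R H c → P * c - Q * c - R * c * H ≡ c * (P - Q - R * H)
            lemma = solve-∀

    -- y·Y divides H² because y divides Y.
    yY∣H² : y * Y ∣ℤ H * H
    yY∣H² = ∣ℤ-* (ℤ∣.∣m⇒∣m*n (eval U y) (ℤ∣.∣m⇒∣m*n (y ^ k) (ℤ∣.∣-refl {y})))
                 (ℤ∣.∣m⇒∣m*n (eval U y) (ℤ∣.∣-refl {Y}))

    -- Hence y·Y divides K·H = K·U(y)·Y, and cancelling Y ≠ 0 gives y | K·U(y).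
    y∣KU[y] : y ∣ℤ K * eval U y
    y∣KU[y] = ℤ∣.*-cancelʳ-∣ Y {{Y≢0}} (subst (y * Y ∣ℤ_) (lemma (F z - b) K Y (eval U y))
      (ℤ∣.∣m∣n⇒∣m-n yY∣F[z]-b (ℤ∣.∣-trans yY∣H² H²∣F[z]-b-KH)))
      where
        Y≢0 : ℤ.NonZero Y
        Y≢0 = ℤ.≢-nonZero (λ Y≡0 → y≢0 (i^n≡0⇒i≡0 y (suc k) Y≡0))
        lemma : ∀ D K Y u → D - (D - K * (Y * u)) ≡ K * u * Y
        lemma = solve-∀

    -- U(y) ≡ U(0) (mod y).
    y∣V : y ∣ℤ V
    y∣V = subst (y ∣ℤ_) (lemma K (eval U y) (eval U (+ 0)))
      (ℤ∣.∣m∣n⇒∣m-n y∣KU[y] (ℤ∣.∣n⇒∣m*n K (eval-cong U y (+ 0) y∣y-0)))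
      where
        y∣y-0 : y ∣ℤ y - + 0
        y∣y-0 = subst (y ∣ℤ_) (sym (+-identityʳ y)) (ℤ∣.∣-refl {y})
        lemma : ∀ K u v → K * u - K * (u - v) ≡ K * v
        lemma = solve-∀

  impossible : ⊥
  impossible = no-large-divisor V V≢0 (AtPoint.y∣V (+ suc ∣ V ∣) (λ ()))

∣y∣≤∣y^r*g∣ : ∀ y g r → 1 ≤ r → ¬ y ≡ + 0 → ¬ g ≡ + 0 → ∣ y ∣ ≤ ∣ y ^ r * g ∣
∣y∣≤∣y^r*g∣ y g (suc r) _ y≢0 g≢0 = begin
  ∣ y ∣                       ≤⟨ ℕP.m≤m*n ∣ y ∣ ∣ y ^ r * g ∣ {{ℤ.≢-nonZero y^r*g≢0}} ⟩
  ∣ y ∣ ℕ.* ∣ y ^ r * g ∣     ≡⟨ abs-* y (y ^ r * g) ⟨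
  ∣ y * (y ^ r * g) ∣         ≡⟨ cong ∣_∣ (*-assoc y (y ^ r) g) ⟨
  ∣ y * y ^ r * g ∣           ∎
  where
    open ℕP.≤-Reasoning
    y^r*g≢0 : ¬ y ^ r * g ≡ + 0
    y^r*g≢0 e with i*j≡0⇒i≡0∨j≡0 (y ^ r) e
    ... | inj₁ y^r≡0 = y≢0 (i^n≡0⇒i≡0 y r y^r≡0)
    ... | inj₂ g≡0   = g≢0 g≡0

cofactor-≥2 : ∀ {a u A C} → a ℕ.* u ≡ A → u ≤ C → C < A → 2 ≤ a
cofactor-≥2 {zero}        refl _   C<0 = ⊥-elim (ℕP.n≮0 C<0)
cofactor-≥2 {suc zero}    refl u≤C C<u =
  ⊥-elim (ℕP.<⇒≱ C<u (subst (_≤ _) (sym (ℕP.+-identityʳ _)) u≤C))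
cofactor-≥2 {suc (suc a)} _    _   _   = s≤s (s≤s z≤n)

prime-not-shared : ∀ {p m n} → Prime p → p ∣ m → p ∣ n → ¬ gcd m n ≡ 1
prime-not-shared p-prime p∣m p∣n gcd≡1 =
  ¬prime[1] (subst Prime (ℕ∣.∣1⇒≡1 (subst (_ ∣_) gcd≡1 (gcd-greatest p∣m p∣n))) p-prime)

private-prime : (a : ℕ → ℕ) → (∀ m n → ¬ m ≡ n → gcd (a m) (a n) ≡ 1) →
  ∀ n → 2 ≤ a n → Σ ℕ λ p → Prime p × p ∣ a n × (∀ m → ¬ m ≡ n → ¬ p ∣ a m)
private-prime a coprime n a≥2 with prime-divisor (a n) a≥2
... | p , p-prime , p∣aₙ = p , p-prime , p∣aₙ ,
  λ m m≢n p∣aₘ → prime-not-shared p-prime p∣aₘ p∣aₙ (coprime m n m≢n)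

module Setting (f G : Poly) (r : ℕ) (x0 : ℤ)
    (f[0]≢0 : ¬ eval f (+ 0) ≡ + 0)
    (f²[0]≡0 : eval f (eval f (+ 0)) ≡ + 0)
    (f∘f≐ : comp f f ≐ (Xpow r ⊛ G))
    (G[0]≢0 : ¬ eval G (+ 0) ≡ + 0)
    (1≤r : 1 ≤ r)
    (wandering : ∀ m n → ¬ m ≡ n → ¬ orbit f x0 m ≡ orbit f x0 n) where

  F : ℤ → ℤ
  F = eval f

  b c : ℤ
  b = F (+ 0)
  c = eval G (+ 0)

  C : ℕ
  C = ∣ c * b ∣

  x Gx : ℕ → ℤ
  x = orbit f x0
  Gx n = eval G (x n)

  a : ℕ → ℕ
  a n = ∣ aTerm f G x0 n ∣

  F∘F : ∀ y → F (F y) ≡ y ^ r * eval G y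
  F∘F y = begin
    F (F y)                    ≡⟨ eval-comp f f y ⟨
    eval (comp f f) y          ≡⟨ eval-≐ (comp f f) (Xpow r ⊛ G) y f∘f≐ ⟩
    eval (Xpow r ⊛ G) y        ≡⟨ eval-⊛ (Xpow r) G y ⟩
    eval (Xpow r) y * eval G y ≡⟨ cong (_* eval G y) (eval-Xpow r y) ⟩
    y ^ r * eval G y           ∎
    where open ≡-Reasoning

  C≢0 : ¬ C ≡ 0
  C≢0 C≡0 with i*j≡0⇒i≡0∨j≡0 c (∣i∣≡0⇒i≡0 C≡0)
  ... | inj₁ c≡0 = G[0]≢0 c≡0
  ... | inj₂ b≡0 = f[0]≢0 b≡0

  a-cofactor : ∀ n → a n ℕ.* gcd ∣ Gx n ∣ C ≡ ∣ Gx n ∣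
  a-cofactor n with gcd ∣ Gx n ∣ C in u≡
  ... | zero  = ⊥-elim (C≢0 (gcd[m,n]≡0⇒n≡0 ∣ Gx n ∣ u≡))
  ... | suc u =
    exact-division (Gx n) (suc u) (subst (_∣ ∣ Gx n ∣) u≡ (gcd[m,n]∣m ∣ Gx n ∣ C))

  -- If d | G(x_m) then d | x_{m+2} = x_m^r G(x_m), so the orbit from x_{m+2} on is
  -- congruent mod d to the orbit 0, b, 0, b, ... of 0.
  follows-orbit-of-0 : ∀ {d} m → d ∣ℤ Gx m →
    ∀ j → d ∣ℤ x (j ℕ.+ suc (suc m)) - iter F j (+ 0)
  follows-orbit-of-0 {d} m d∣Gx j =
    subst (λ t → d ∣ℤ t - iter F j (+ 0)) (sym (iter-+ F j (suc (suc m)) x0))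
      (iter-cong f j (x (suc (suc m))) (+ 0) d∣x[m+2]-0)
    where
      d∣x[m+2]-0 : d ∣ℤ x (suc (suc m)) - + 0
      d∣x[m+2]-0 = subst (d ∣ℤ_) (trans (sym (F∘F (x m))) (sym (+-identityʳ _)))
        (ℤ∣.∣n⇒∣m*n (x m ^ r) d∣Gx)

  -- Every common divisor of G(x_m) and G(x_n), m < n, divides c·b: according to the
  -- parity of n - m, either x_{n+2} ≡ b or x_n ≡ 0 (mod d); in the first case d | x_{n+2}
  -- gives d | b, in the second G(x_n) ≡ c gives d | c.
  common-divisor : ∀ {d} m s → d ∣ℤ Gx m → d ∣ℤ Gx (m ℕ.+ suc s) → d ∣ℤ c * b
  common-divisor {d} m s d∣Gxₘ d∣Gxₙ with parity s
  ... | k , inj₁ refl = ℤ∣.∣n⇒∣m*n c d∣b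
    where
      n+2≡ : suc (k ℕ.+ k) ℕ.+ suc (suc m) ≡ suc (suc (m ℕ.+ suc (k ℕ.+ k)))
      n+2≡ = lemma k m
        where lemma : ∀ k m → suc (k ℕ.+ k) ℕ.+ suc (suc m) ≡ suc (suc (m ℕ.+ suc (k ℕ.+ k)))
              lemma = ℕSolver.solve-∀
      n = m ℕ.+ suc (k ℕ.+ k)
      d∣x[n+2]-b : d ∣ℤ x (suc (suc n)) - b
      d∣x[n+2]-b = subst₂ (λ t u → d ∣ℤ x t - u) n+2≡ (cong F (period-two F f²[0]≡0 k))
        (follows-orbit-of-0 m d∣Gxₘ (suc (k ℕ.+ k)))
      d∣x[n+2] : d ∣ℤ x (suc (suc n))
      d∣x[n+2] = subst (d ∣ℤ_) (sym (F∘F (x n))) (ℤ∣.∣n⇒∣m*n (x n ^ r) d∣Gxₙ)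
      d∣b : d ∣ℤ b
      d∣b = subst (d ∣ℤ_) (lemma (x (suc (suc n))) b) (ℤ∣.∣m∣n⇒∣m-n d∣x[n+2] d∣x[n+2]-b)
        where lemma : ∀ t b → t - (t - b) ≡ b
              lemma = solve-∀
  ... | k , inj₂ refl = ℤ∣.∣m⇒∣m*n b d∣c
    where
      n≡ : k ℕ.+ k ℕ.+ suc (suc m) ≡ m ℕ.+ suc (suc (k ℕ.+ k))
      n≡ = lemma k m
        where lemma : ∀ k m → k ℕ.+ k ℕ.+ suc (suc m) ≡ m ℕ.+ suc (suc (k ℕ.+ k))
              lemma = ℕSolver.solve-∀
      n = m ℕ.+ suc (suc (k ℕ.+ k))
      d∣xₙ-0 : d ∣ℤ x n - + 0
      d∣xₙ-0 = subst₂ (λ t u → d ∣ℤ x t - u) n≡ (period-two F f²[0]≡0 k)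
        (follows-orbit-of-0 m d∣Gxₘ (k ℕ.+ k))
      d∣c : d ∣ℤ c
      d∣c = subst (d ∣ℤ_) (lemma (Gx n) c)
        (ℤ∣.∣m∣n⇒∣m-n d∣Gxₙ (eval-cong G (x n) (+ 0) d∣xₙ-0))
        where lemma : ∀ t c → t - (t - c) ≡ c
              lemma = solve-∀

  ordered-common-divisors : ∀ m n → m < n → ∀ D → D ∣ ∣ Gx m ∣ → D ∣ ∣ Gx n ∣ → D ∣ C
  ordered-common-divisors m n m<n D D∣Gxₘ D∣Gxₙ with ℕP.m≤n⇒∃[o]m+o≡n m<n
  ... | s , 1+m+s≡n = ℤ∣.∣⇒∣ᵤ {+ D} {c * b} (common-divisor m s
    (ℤ∣.∣ᵤ⇒∣ {+ D} {Gx m} D∣Gxₘ)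
    (ℤ∣.∣ᵤ⇒∣ {+ D} {Gx (m ℕ.+ suc s)}
      (subst (λ t → D ∣ ∣ Gx t ∣) (sym (trans (ℕP.+-suc m s) 1+m+s≡n)) D∣Gxₙ)))

  common-divisors : ∀ m n → ¬ m ≡ n → ∀ D → D ∣ ∣ Gx m ∣ → D ∣ ∣ Gx n ∣ → D ∣ C
  common-divisors m n m≢n D D∣Gxₘ D∣Gxₙ with ℕP.<-cmp m n
  ... | tri< m<n _ _ = ordered-common-divisors m n m<n D D∣Gxₘ D∣Gxₙ
  ... | tri≈ _ m≡n _ = ⊥-elim (m≢n m≡n)
  ... | tri> _ _ n<m = ordered-common-divisors n m n<m D D∣Gxₙ D∣Gxₘ

  a-coprime : ∀ m n → ¬ m ≡ n → gcd (a m) (a n) ≡ 1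
  a-coprime m n m≢n = coprime-cofactors {∣ Gx m ∣} {∣ Gx n ∣} {C} {a m} {a n} C≢0
    (a-cofactor m) (a-cofactor n) (common-divisors m n m≢n)

  -- G is not constant.  If G ≡ c then F(F(y)) = y^r·c.  For r = 1, b = F(F(b)) = b·c
  -- forces c = 1, so x_2 = x_0, contradicting wandering; r ≥ 2 is impossible outright.
  G-nonconstant : NonConstant G
  G-nonconstant = nonConstant G λ const →
    by-exponent r refl (λ y → trans (F∘F y) (cong (y ^ r *_) (const y)))
    where
      by-exponent : ∀ s → s ≡ r → (∀ y → F (F y) ≡ y ^ s * c) → ⊥
      by-exponent zero          s≡r _   = ℕP.<-irrefl refl (subst (1 ≤_) (sym s≡r) 1≤r)
      by-exponent (suc (suc n)) _   F∘F≡ = NoMonomialIterate.impossible f c n f[0]≢0 G[0]≢0 F∘F≡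
      by-exponent (suc zero)    _   F∘F≡ = wandering 2 0 (λ ()) (involution x0)
        where
          F∘F≡y·c : ∀ y → F (F y) ≡ y * c
          F∘F≡y·c y = trans (F∘F≡ y) (cong (_* c) (^-identityʳ y))
          c≡1 : c ≡ + 1
          c≡1 = sym (*-cancelˡ-≡ b (+ 1) c {{ℤ.≢-nonZero f[0]≢0}}
            (trans (*-identityʳ b) (trans (sym (cong F f²[0]≡0)) (F∘F≡y·c b))))
          involution : ∀ y → F (F y) ≡ y
          involution y = trans (F∘F≡y·c y) (trans (cong (y *_) c≡1) (*-identityʳ y))

  -- f is not constant, since F(b) = 0 ≠ b = F(0).
  f-nonconstant : NonConstant f
  f-nonconstant = nonConstant f λ const → f[0]≢0 (trans (sym (const b)) f²[0]≡0)

  B₀ B₁ : ℕ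
  B₀ = proj₁ (growth G G-nonconstant C)
  B₁ = proj₁ (growth f f-nonconstant B₀)

  G-large : ∀ y → B₀ ≤ ∣ y ∣ → C < ∣ eval G y ∣
  G-large = proj₂ (growth G G-nonconstant C)

  F-large : ∀ y → B₁ ≤ ∣ y ∣ → B₀ < ∣ F y ∣
  F-large = proj₂ (growth f f-nonconstant B₀)

  -- Beyond B₀, two steps of F do not decrease the size: |F(F(y))| = |y^r G(y)| ≥ |y|.
  two-steps : ∀ y → suc B₀ ≤ ∣ y ∣ → ∣ y ∣ ≤ ∣ F (F y) ∣
  two-steps y large = subst (λ t → ∣ y ∣ ≤ ∣ t ∣) (sym (F∘F y))
    (∣y∣≤∣y^r*g∣ y (eval G y) r 1≤r y≢0 G[y]≢0)
    where
      y≢0 : ¬ y ≡ + 0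
      y≢0 refl = ℕP.n≮0 large
      G[y]≢0 : ¬ eval G y ≡ + 0
      G[y]≢0 G[y]≡0 = ℕP.n≮0 (subst (λ t → C < ∣ t ∣) G[y]≡0
        (G-large y (ℕP.≤-trans (ℕP.n≤1+n B₀) large)))

  -- The orbit wanders, so it reaches size B₀ + 1 + B₁ at some index N; from then on it
  -- keeps size at least B₀ + 1.
  eventually-large : Σ ℕ λ N → ∀ n → N ≤ n → suc B₀ ≤ ∣ x n ∣
  eventually-large with unbounded x wandering (suc B₀ ℕ.+ B₁)
  ... | N , reached = N , λ n N≤n → from-N n (ℕP.m≤n⇒∃[o]m+o≡n N≤n)
    where
      one-step : ∀ y → suc B₀ ℕ.+ B₁ ≤ ∣ y ∣ → suc B₀ ≤ ∣ F y ∣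
      one-step y large = F-large y (ℕP.≤-trans (ℕP.m≤n+m B₁ (suc B₀)) large)
      from-N : ∀ n → (Σ ℕ λ t → N ℕ.+ t ≡ n) → suc B₀ ≤ ∣ x n ∣
      from-N n (t , N+t≡n) = subst (λ i → suc B₀ ≤ ∣ x i ∣) (trans (ℕP.+-comm t N) N+t≡n)
        (subst (λ z → suc B₀ ≤ ∣ z ∣) (sym (iter-+ F t N x0))
          (stays-large F (ℕP.m≤m+n (suc B₀) B₁) two-steps one-step (x N) reached t))

  -- Once |x_n| > B₀ we have |G(x_n)| > C ≥ gcd(|G(x_n)|, C), so a_n ≥ 2.
  a-≥2 : ∀ n → suc B₀ ≤ ∣ x n ∣ → 2 ≤ a n
  a-≥2 n large = cofactor-≥2 (a-cofactor n)
    (ℕ∣.∣⇒≤ {{ℕ.≢-nonZero C≢0}} (gcd[m,n]∣n ∣ Gx n ∣ C))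
    (G-large (x n) (ℕP.≤-trans (ℕP.n≤1+n B₀) large))

  eventually-private-primes : Σ ℕ λ N → ∀ n → N ≤ n →
    Σ ℕ λ p → Prime p × p ∣ a n × (∀ m → ¬ m ≡ n → ¬ p ∣ a m)
  eventually-private-primes with eventually-large
  ... | N , large = N , λ n N≤n → private-prime a a-coprime n (a-≥2 n (large n N≤n))

theorem6 : (f G : Poly) (r : ℕ) (x0 : ℤ)
    → NonConstant (f ⊕ Xp)
    → ¬ (eval f (+ 0) ≡ + 0)
    → eval f (eval f (+ 0)) ≡ + 0
    → comp f f ≐ (Xpow r ⊛ G)
    → ¬ (eval G (+ 0) ≡ + 0)
    → 1 ≤ r
    → (∀ m n → ¬ (m ≡ n) → ¬ (orbit f x0 m ≡ orbit f x0 n))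
    → (∀ m n → ¬ (m ≡ n) → gcd ∣ aTerm f G x0 m ∣ ∣ aTerm f G x0 n ∣ ≡ 1)
      × Σ ℕ (λ N → ∀ n → N ≤ n →
          Σ ℕ (λ p → Prime p × (p ∣ ∣ aTerm f G x0 n ∣)
            × (∀ m → ¬ (m ≡ n) → ¬ (p ∣ ∣ aTerm f G x0 m ∣))))
theorem6 f G r x0 _ f[0]≢0 f²[0]≡0 f∘f≐ G[0]≢0 1≤r wandering =
  a-coprime , eventually-private-primes
  where open Setting f G r x0 f[0]≢0 f²[0]≡0 f∘f≐ G[0]≢0 1≤r wandering
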